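{- Let $1\leq m\leq k$, $n\geq k+1$ and $l$ a positive integer. Then $$op_{n,k,=l}^m=\sum_{j=m+1}^{k+1}\sum_{i=1}^{n-k}c_i\,op_{n-i,k,=l-i}^{j},$$ where $c_i=\frac{1}{i+1}\binom{2i}{i}$ is the $i$-th Catalan number and $op_{n,k,=l}^m$ denotes the number of ordered preference sets $(a_1,\dots,a_n)$ of length $n$ with exactly $k$ flaws, leading term $a_1=m$ and $\max_i a_i=l$.
   Context: Parking model: $n$ parking spaces numbered $1,\dots,n$ from left to right; a preference set of length $n$ is a sequence $(a_1,\dots,a_n)$ with $a_i\in[n]$. Cars arrive in order; car $i$ goes to space $a_i$, and if it is occupied, moves to the first unoccupied space to the right; if there is none, the car cannot park. The number of flaws is the number of cars that cannot park. A preference set is ordered if $a_1\leq\cdots\leq a_n$; its leading term is $a_1$. A count over an empty set is $0$. -}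

module Defs where

open import Data.Nat using (ℕ; zero; suc; _+_; _∸_; _⊔_; _≤_; _/_; _≟_; _≤?_; _*_)
open import Data.Nat.Properties using (≤-totalOrder)
open import Data.Nat.Combinatorics using (_C_)
open import Data.Bool using (Bool; true; false)
open import Data.Product using (_×_; _,_; proj₁; proj₂)
open import Data.Maybe using (Maybe; just; nothing)
open import Data.List using (List; []; _∷_; map; concatMap; upTo; length; filter; foldr; head)
open import Relation.Binary.PropositionalEquality using (_≡_)
open import Relation.Nullary using (Dec)
open import Relation.Nullary.Decidable using (_×-dec_)
import Data.List.Relation.Unary.Sorted.TotalOrder as Sorted
open import Data.Maybe.Properties using (≡-dec)

-- Attempt to park a car preferring space a (1-based) in the street `bs`
-- (false = free, true = occupied).  The car drives to space a, then moves right to the first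
-- free space; if none exists it cannot park.
tryPark : ℕ → List Bool → Bool × List Bool
tryPark _ [] = false , []
tryPark (suc (suc a)) (b ∷ bs) with tryPark (suc a) bs
... | (p , bs') = p , (b ∷ bs')
tryPark a (false ∷ bs) = true , (true ∷ bs)
tryPark a (true ∷ bs) with tryPark a bs
... | (p , bs') = p , (true ∷ bs')

flawsFrom : List ℕ → List Bool → ℕ
flawsFrom [] bs = 0
flawsFrom (a ∷ as) bs with tryPark a bs
... | (true , bs') = flawsFrom as bs'
... | (false , bs') = suc (flawsFrom as bs')

emptyStreet : ℕ → List Bool
emptyStreet zero = []
emptyStreet (suc n) = false ∷ emptyStreet n

flaws : ℕ → List ℕ → ℕ
flaws n as = flawsFrom as (emptyStreet n)

seqs : ℕ → ℕ → List (List ℕ)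
seqs zero n = [] ∷ []
seqs (suc len) n = concatMap (λ a → map (a ∷_) (seqs len n)) (map suc (upTo n))

prefSets : ℕ → List (List ℕ)
prefSets n = seqs n n

Ordered : List ℕ → Set
Ordered = Sorted.Sorted ≤-totalOrder

maxEntry : List ℕ → ℕ
maxEntry = foldr _⊔_ 0

OpProp : ℕ → ℕ → ℕ → ℕ → List ℕ → Set
OpProp n k l m as = Ordered as × (flaws n as ≡ k) × (head as ≡ just m) × (maxEntry as ≡ l)

opProp? : ∀ n k l m as → Dec (OpProp n k l m as)
opProp? n k l m as =
  Sorted.sorted? ≤-totalOrder _≤?_ as ×-dec (flaws n as ≟ k) ×-dec (≡-dec _≟_ (head as) (just m)) ×-dec (maxEntry as ≟ l)

op : (n k l m : ℕ) → ℕ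
op n k l m = length (filter (opProp? n k l m) (prefSets n))

catalan : ℕ → ℕ
catalan i = ((2 * i) C i) / suc i

-- Σ_{i=a}^{b} f i  (0 if b < a)
sumFromTo : ℕ → ℕ → (ℕ → ℕ) → ℕ
sumFromTo a b f = foldr _+_ 0 (map (λ t → f (a + t)) (upTo (suc b ∸ a)))

-- Split an ordered preference set with leading term m after its initial block, the longest
-- prefix a₁, …, a_i with a_j ≤ m + j − 1. These cars fill the spaces m, …, m + i − 1, there are
-- c_i such prefixes (a ballot count), and 1 ≤ i ≤ n − k because a longer block would let too
-- many cars park. All later cars prefer spaces beyond m + i: shifted down by m + i they form an
-- ordered preference set on n − m − i spaces with k flaws and maximum l − m − i. Shifting down
-- by m instead identifies the same tails with the ordered preference sets of length n − i with
-- k flaws, maximum l − i and leading term j > m, where necessarily j ≤ k + 1.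
module Submission where

open import Defs
open import Data.Bool using (Bool; true; false)
open import Data.Empty using (⊥-elim)
open import Data.List
  using (List; []; _∷_; _++_; map; concatMap; applyUpTo; upTo; length; filter; foldr; replicate; take; drop)
open import Data.List.Properties
  using (length-map; length-++; length-replicate; ++-assoc; take++drop≡id; length-take; length-drop)
open import Data.List.Relation.Unary.All using (All; []; _∷_; all?)
import Data.List.Relation.Unary.All as All
open import Data.List.Relation.Unary.Linked using ([]; [-]; _∷_)
import Data.List.Relation.Unary.Linked as Linked
import Data.List.Relation.Unary.Linked.Properties as LinkedProperties
import Data.List.Relation.Unary.Sorted.TotalOrder as Sorted
import Data.List.Relation.Unary.Sorted.TotalOrder.Properties as SortedProperties
open import Data.Maybe using (just)
open import Data.Maybe.Properties using (just-injective)
open import Data.Nat using (ℕ; zero; suc; _+_; _*_; _∸_; _⊔_; _≤_; _<_; _≟_; _≤?_; _<?_; z≤n; s≤s; z<s; _/_)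
open import Data.Nat.Combinatorics
  using (_C_; nCk≡nC[n∸k]; nCn≡1; k>n⇒nCk≡0; nC1≡n) renaming (nCk+nC[k+1]≡[n+1]C[k+1] to pascal)
open import Data.Nat.DivMod using (m*n/n≡m)
open import Data.Nat.Properties
open import Algebra.Properties.CommutativeSemigroup +-commutativeSemigroup using (interchange)
open import Data.Nat.Tactic.RingSolver using (solve-∀)
open import Data.Product using (_×_; _,_; proj₁; proj₂; map₂)
open import Data.Unit using (⊤; tt)
open import Function using (_∘_)
open import Relation.Binary.PropositionalEquality
open import Relation.Nullary using (Dec; yes; no; ¬_)
open import Relation.Nullary.Decidable using (_×-dec_)

𝟙 : ∀ {a} {A : Set a} → Dec A → ℕ
𝟙 (yes _) = 1
𝟙 (no _)  = 0

𝟙-cong : ∀ {a b} {A : Set a} {B : Set b} → (A → B) → (B → A) → (x : Dec A) (y : Dec B) → 𝟙 x ≡ 𝟙 y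
𝟙-cong f g (yes p) (yes q) = refl
𝟙-cong f g (yes p) (no ¬q) = ⊥-elim (¬q (f p))
𝟙-cong f g (no ¬p) (yes q) = ⊥-elim (¬p (g q))
𝟙-cong f g (no ¬p) (no ¬q) = refl

𝟙-yes : ∀ {a} {A : Set a} → A → (x : Dec A) → 𝟙 x ≡ 1
𝟙-yes p (yes _) = refl
𝟙-yes p (no ¬p) = ⊥-elim (¬p p)

𝟙-no : ∀ {a} {A : Set a} → ¬ A → (x : Dec A) → 𝟙 x ≡ 0
𝟙-no ¬p (yes p) = ⊥-elim (¬p p)
𝟙-no ¬p (no _)  = refl

𝟙-× : ∀ {a b} {A : Set a} {B : Set b} (x : Dec A) (y : Dec B) → 𝟙 (x ×-dec y) ≡ 𝟙 x * 𝟙 y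
𝟙-× (yes _) (yes _) = refl
𝟙-× (yes _) (no _)  = refl
𝟙-× (no _)  _       = refl

𝟙-*-cong : ∀ {a} {A : Set a} (x : Dec A) {b c : ℕ} → (A → b ≡ c) → 𝟙 x * b ≡ 𝟙 x * c
𝟙-*-cong (yes p) b≡c = cong (1 *_) (b≡c p)
𝟙-*-cong (no _)  _   = refl

sumOver : ∀ {X : Set} → (X → ℕ) → List X → ℕ
sumOver f []       = 0
sumOver f (x ∷ xs) = f x + sumOver f xs

module _ {X : Set} where

  length-filter : ∀ {p} {P : X → Set p} (P? : ∀ x → Dec (P x)) xs →
                  length (filter P? xs) ≡ sumOver (𝟙 ∘ P?) xs
  length-filter P? []       = refl
  length-filter P? (x ∷ xs) with P? x
  ... | yes _ = cong suc (length-filter P? xs)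
  ... | no _  = length-filter P? xs

  sumOver-cong : ∀ {f g : X → ℕ} → (∀ x → f x ≡ g x) → ∀ xs → sumOver f xs ≡ sumOver g xs
  sumOver-cong f≡g []       = refl
  sumOver-cong f≡g (x ∷ xs) = cong₂ _+_ (f≡g x) (sumOver-cong f≡g xs)

  sumOver-zero : ∀ {f : X → ℕ} → (∀ x → f x ≡ 0) → ∀ xs → sumOver f xs ≡ 0
  sumOver-zero f≡0 []       = refl
  sumOver-zero f≡0 (x ∷ xs) rewrite f≡0 x = sumOver-zero f≡0 xs

  sumOver-++ : ∀ (f : X → ℕ) xs ys → sumOver f (xs ++ ys) ≡ sumOver f xs + sumOver f ys
  sumOver-++ f []       ys = refl
  sumOver-++ f (x ∷ xs) ys = trans (cong (f x +_) (sumOver-++ f xs ys)) (sym (+-assoc (f x) _ _))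

  sumOver-+ : ∀ (f g : X → ℕ) xs → sumOver (λ x → f x + g x) xs ≡ sumOver f xs + sumOver g xs
  sumOver-+ f g []       = refl
  sumOver-+ f g (x ∷ xs) rewrite sumOver-+ f g xs = interchange (f x) (g x) (sumOver f xs) (sumOver g xs)

  sumOver-*ˡ : ∀ (f : X → ℕ) c xs → sumOver (λ x → c * f x) xs ≡ c * sumOver f xs
  sumOver-*ˡ f c []       = sym (*-zeroʳ c)
  sumOver-*ˡ f c (x ∷ xs) = trans (cong (c * f x +_) (sumOver-*ˡ f c xs)) (sym (*-distribˡ-+ c (f x) _))

  sumOver-*ʳ : ∀ (f : X → ℕ) c xs → sumOver (λ x → f x * c) xs ≡ sumOver f xs * c
  sumOver-*ʳ f c []       = refl
  sumOver-*ʳ f c (x ∷ xs) = trans (cong (f x * c +_) (sumOver-*ʳ f c xs)) (sym (*-distribʳ-+ c (f x) _))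

sumOver-concatMap : ∀ {X Y : Set} (f : Y → ℕ) (g : X → List Y) xs →
                    sumOver f (concatMap g xs) ≡ sumOver (λ x → sumOver f (g x)) xs
sumOver-concatMap f g []       = refl
sumOver-concatMap f g (x ∷ xs) =
  trans (sumOver-++ f (g x) (concatMap g xs)) (cong (sumOver f (g x) +_) (sumOver-concatMap f g xs))

sumOver-map : ∀ {X Y : Set} (f : Y → ℕ) (g : X → Y) xs → sumOver f (map g xs) ≡ sumOver (f ∘ g) xs
sumOver-map f g []       = refl
sumOver-map f g (x ∷ xs) = cong (f (g x) +_) (sumOver-map f g xs)

sumFrom : ℕ → ℕ → (ℕ → ℕ) → ℕ
sumFrom a zero    f = 0
sumFrom a (suc c) f = f a + sumFrom (suc a) c f

sumFrom-suc : ∀ a c f → sumFrom (suc a) c f ≡ sumFrom a c (f ∘ suc)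
sumFrom-suc a zero    f = refl
sumFrom-suc a (suc c) f = cong (f (suc a) +_) (sumFrom-suc (suc a) c f)

sumFrom-+ˡ : ∀ d a c f → sumFrom (d + a) c f ≡ sumFrom a c (λ t → f (d + t))
sumFrom-+ˡ zero    a c f = refl
sumFrom-+ˡ (suc d) a c f = trans (sumFrom-suc (d + a) c f) (sumFrom-+ˡ d a c (f ∘ suc))

sumFrom-cong : ∀ a c {f g} → (∀ t → a ≤ t → t < a + c → f t ≡ g t) → sumFrom a c f ≡ sumFrom a c g
sumFrom-cong a zero    f≡g = refl
sumFrom-cong a (suc c) f≡g = cong₂ _+_ (f≡g a ≤-refl (m<m+n a z<s))
  (sumFrom-cong (suc a) c (λ t a<t t<end → f≡g t (<⇒≤ a<t) (subst (t <_) (sym (+-suc a c)) t<end)))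

sumFrom-zero : ∀ a c {f} → (∀ t → a ≤ t → t < a + c → f t ≡ 0) → sumFrom a c f ≡ 0
sumFrom-zero a zero    f≡0 = refl
sumFrom-zero a (suc c) f≡0 = cong₂ _+_ (f≡0 a ≤-refl (m<m+n a z<s))
  (sumFrom-zero (suc a) c (λ t a<t t<end → f≡0 t (<⇒≤ a<t) (subst (t <_) (sym (+-suc a c)) t<end)))

sumFrom-++ : ∀ a c d f → sumFrom a (c + d) f ≡ sumFrom a c f + sumFrom (a + c) d f
sumFrom-++ a zero    d f rewrite +-identityʳ a = refl
sumFrom-++ a (suc c) d f rewrite sumFrom-++ (suc a) c d f | +-suc a c = sym (+-assoc (f a) _ _)

sumFrom-+ : ∀ a c f g → sumFrom a c (λ t → f t + g t) ≡ sumFrom a c f + sumFrom a c g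
sumFrom-+ a zero    f g = refl
sumFrom-+ a (suc c) f g rewrite sumFrom-+ (suc a) c f g =
  interchange (f a) (g a) (sumFrom (suc a) c f) (sumFrom (suc a) c g)

sumFrom-*ˡ : ∀ a c f k → sumFrom a c (λ t → k * f t) ≡ k * sumFrom a c f
sumFrom-*ˡ a zero    f k = sym (*-zeroʳ k)
sumFrom-*ˡ a (suc c) f k = trans (cong (k * f a +_) (sumFrom-*ˡ (suc a) c f k)) (sym (*-distribˡ-+ k (f a) _))

sumFrom-*ʳ : ∀ a c f k → sumFrom a c (λ t → f t * k) ≡ sumFrom a c f * k
sumFrom-*ʳ a zero    f k = refl
sumFrom-*ʳ a (suc c) f k = trans (cong (f a * k +_) (sumFrom-*ʳ (suc a) c f k)) (sym (*-distribʳ-+ k (f a) _))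

sumOver-sumFrom : ∀ {X : Set} (f : X → ℕ → ℕ) a c xs →
                  sumOver (λ x → sumFrom a c (f x)) xs ≡ sumFrom a c (λ t → sumOver (λ x → f x t) xs)
sumOver-sumFrom f a zero    xs = sumOver-zero (λ _ → refl) xs
sumOver-sumFrom f a (suc c) xs = trans (sumOver-+ (λ x → f x a) (λ x → sumFrom (suc a) c (f x)) xs)
  (cong (sumOver (λ x → f x a) xs +_) (sumOver-sumFrom f (suc a) c xs))

sumFrom-comm : ∀ a c b d (f : ℕ → ℕ → ℕ) →
               sumFrom a c (λ s → sumFrom b d (f s)) ≡ sumFrom b d (λ t → sumFrom a c (λ s → f s t))
sumFrom-comm a zero    b d f = sym (sumFrom-zero b d (λ _ _ _ → refl))
sumFrom-comm a (suc c) b d f =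
  trans (cong (sumFrom b d (f a) +_) (sumFrom-comm (suc a) c b d f)) (sym (sumFrom-+ b d (f a) _))

sumFrom-window : ∀ a b c d {f g} →
  (∀ t → t < a + b → f t ≡ 0) →
  (∀ t → a + b ≤ t → t < a + b + c → f t ≡ g t) →
  (∀ t → a + b + c ≤ t → t < a + b + c + d → f t ≡ 0) →
  sumFrom a (b + c + d) f ≡ sumFrom (a + b) c g
sumFrom-window a b c d {f} {g} below inside above = begin
  sumFrom a (b + c + d) f
    ≡⟨ sumFrom-++ a (b + c) d f ⟩
  sumFrom a (b + c) f + sumFrom (a + (b + c)) d f
    ≡⟨ cong₂ _+_ (sumFrom-++ a b c f) (sumFrom-zero _ d beyond) ⟩
  sumFrom a b f + sumFrom (a + b) c f + 0
    ≡⟨ cong₂ (λ x y → x + y + 0) (sumFrom-zero a b (λ t _ → below t)) (sumFrom-cong (a + b) c inside) ⟩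
  0 + sumFrom (a + b) c g + 0
    ≡⟨ +-identityʳ _ ⟩
  sumFrom (a + b) c g
    ∎
  where
  open ≡-Reasoning
  assoc : a + (b + c) ≡ a + b + c
  assoc = sym (+-assoc a b c)
  beyond : ∀ t → a + (b + c) ≤ t → t < a + (b + c) + d → f t ≡ 0
  beyond t p q = above t (subst (_≤ t) assoc p) (subst (λ e → t < e + d) assoc q)

sumFrom-δ-in : ∀ a c x → a ≤ x → x < a + c → sumFrom a c (λ t → 𝟙 (x ≟ t)) ≡ 1
sumFrom-δ-in a zero    x a≤x x<a+c = ⊥-elim (<⇒≱ x<a+c (subst (_≤ x) (sym (+-identityʳ a)) a≤x))
sumFrom-δ-in a (suc c) x a≤x x<a+c with x ≟ a
... | yes refl = cong suc (sumFrom-zero (suc a) c (λ t a<t _ → 𝟙-no (λ x≡t → <⇒≢ a<t x≡t) (x ≟ t)))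
... | no x≢a   = sumFrom-δ-in (suc a) c x (≤∧≢⇒< a≤x (x≢a ∘ sym)) (subst (x <_) (+-suc a c) x<a+c)

sumFrom-δ : ∀ a c x → sumFrom a c (λ t → 𝟙 (x ≟ t)) ≡ 𝟙 ((a ≤? x) ×-dec (x <? a + c))
sumFrom-δ a c x with a ≤? x | x <? a + c
... | yes a≤x | yes x<a+c = sumFrom-δ-in a c x a≤x x<a+c
... | no a≰x  | _         =
  sumFrom-zero a c (λ t a≤t _ → 𝟙-no (λ x≡t → a≰x (subst (a ≤_) (sym x≡t) a≤t)) (x ≟ t))
... | yes _   | no x≮a+c  =
  sumFrom-zero a c (λ t _ t<a+c → 𝟙-no (λ x≡t → x≮a+c (subst (_< a + c) (sym x≡t) t<a+c)) (x ≟ t))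

sumOver-applyUpTo : ∀ (f : ℕ → ℕ) g c → sumOver f (applyUpTo g c) ≡ sumFrom 0 c (f ∘ g)
sumOver-applyUpTo f g zero    = refl
sumOver-applyUpTo f g (suc c) =
  cong (f (g 0) +_) (trans (sumOver-applyUpTo f (g ∘ suc) c) (sym (sumFrom-suc 0 c (f ∘ g))))

foldr-+-map : ∀ (f : ℕ → ℕ) xs → foldr _+_ 0 (map f xs) ≡ sumOver f xs
foldr-+-map f []       = refl
foldr-+-map f (x ∷ xs) = cong (f x +_) (foldr-+-map f xs)

sumFromTo≡sumFrom : ∀ a b f → sumFromTo a b f ≡ sumFrom a (suc b ∸ a) f
sumFromTo≡sumFrom a b f = begin
  foldr _+_ 0 (map (λ t → f (a + t)) (upTo c))  ≡⟨ foldr-+-map _ (upTo c) ⟩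
  sumOver (λ t → f (a + t)) (upTo c)            ≡⟨ sumOver-applyUpTo _ (λ t → t) c ⟩
  sumFrom 0 c (λ t → f (a + t))                 ≡⟨ sumFrom-+ˡ a 0 c f ⟨
  sumFrom (a + 0) c f                           ≡⟨ cong (λ x → sumFrom x c f) (+-identityʳ a) ⟩
  sumFrom a c f                                 ∎
  where
  open ≡-Reasoning
  c = suc b ∸ a

sumOver-seqs-suc : ∀ (w : List ℕ → ℕ) len n →
  sumOver w (seqs (suc len) n) ≡ sumFrom 1 n (λ a → sumOver (λ v → w (a ∷ v)) (seqs len n))
sumOver-seqs-suc w len n = begin
  sumOver w (concatMap (λ a → map (a ∷_) (seqs len n)) (map suc (upTo n)))
    ≡⟨ sumOver-concatMap w _ (map suc (upTo n)) ⟩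
  sumOver (λ a → sumOver w (map (a ∷_) (seqs len n))) (map suc (upTo n))
    ≡⟨ sumOver-cong (λ a → sumOver-map w (a ∷_) (seqs len n)) (map suc (upTo n)) ⟩
  sumOver H (map suc (upTo n))
    ≡⟨ sumOver-map H suc (upTo n) ⟩
  sumOver (H ∘ suc) (upTo n)
    ≡⟨ sumOver-applyUpTo (H ∘ suc) (λ t → t) n ⟩
  sumFrom 0 n (H ∘ suc)
    ≡⟨ sumFrom-suc 0 n H ⟨
  sumFrom 1 n H
    ∎
  where
  open ≡-Reasoning
  H : ℕ → ℕ
  H a = sumOver (λ v → w (a ∷ v)) (seqs len n)

sumOver-seqs-++ : ∀ (w : List ℕ → ℕ) a b n →
  sumOver w (seqs (a + b) n) ≡ sumOver (λ u → sumOver (λ v → w (u ++ v)) (seqs b n)) (seqs a n)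
sumOver-seqs-++ w zero    b n = sym (+-identityʳ _)
sumOver-seqs-++ w (suc a) b n = begin
  sumOver w (seqs (suc a + b) n)
    ≡⟨ sumOver-seqs-suc w (a + b) n ⟩
  sumFrom 1 n (λ x → sumOver (λ v → w (x ∷ v)) (seqs (a + b) n))
    ≡⟨ sumFrom-cong 1 n (λ x _ _ → sumOver-seqs-++ (λ v → w (x ∷ v)) a b n) ⟩
  sumFrom 1 n (λ x → sumOver (λ u → sumOver (λ v → w (x ∷ u ++ v)) (seqs b n)) (seqs a n))
    ≡⟨ sumOver-seqs-suc _ a n ⟨
  sumOver (λ u → sumOver (λ v → w (u ++ v)) (seqs b n)) (seqs (suc a) n)
    ∎
  where open ≡-Reasoning

InRange : ℕ → List ℕ → Set
InRange n = All (λ a → 1 ≤ a × a ≤ n)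

sumOver-seqs-cong : ∀ len n {f g : List ℕ → ℕ} → (∀ xs → length xs ≡ len → InRange n xs → f xs ≡ g xs) →
                    sumOver f (seqs len n) ≡ sumOver g (seqs len n)
sumOver-seqs-cong zero      n f≡g = cong (_+ 0) (f≡g [] refl [])
sumOver-seqs-cong (suc len) n {f} {g} f≡g = begin
  sumOver f (seqs (suc len) n)                               ≡⟨ sumOver-seqs-suc f len n ⟩
  sumFrom 1 n (λ a → sumOver (λ v → f (a ∷ v)) (seqs len n)) ≡⟨ sumFrom-cong 1 n tails ⟩
  sumFrom 1 n (λ a → sumOver (λ v → g (a ∷ v)) (seqs len n)) ≡⟨ sumOver-seqs-suc g len n ⟨
  sumOver g (seqs (suc len) n)                               ∎
  where
  open ≡-Reasoning
  tails : ∀ a → 1 ≤ a → a < 1 + n → sumOver (λ v → f (a ∷ v)) (seqs len n) ≡ sumOver (λ v → g (a ∷ v)) (seqs len n)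
  tails a 1≤a a≤n =
    sumOver-seqs-cong len n (λ xs ∣xs∣≡len r → f≡g (a ∷ xs) (cong suc ∣xs∣≡len) ((1≤a , ≤-pred a≤n) ∷ r))

𝟙-all-∷ : ∀ d a v → 𝟙 (all? (d <?_) (a ∷ v)) ≡ 𝟙 (d <? a) * 𝟙 (all? (d <?_) v)
𝟙-all-∷ d a v =
  trans (𝟙-cong All.uncons (λ (p , ps) → p ∷ ps) _ ((d <? a) ×-dec all? (d <?_) v)) (𝟙-× (d <? a) _)

sumFrom-𝟙< : ∀ d n (H : ℕ → ℕ) →
             sumFrom 1 n (λ a → 𝟙 (d <? a) * H a) ≡ sumFrom 1 (n ∸ d) (λ b → H (d + b))
sumFrom-𝟙< d n H with d ≤? n
... | yes d≤n = begin
  sumFrom 1 n F                       ≡⟨ cong (λ x → sumFrom 1 x F) (sym n≡) ⟩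
  sumFrom 1 (d + (n ∸ d) + 0) F       ≡⟨ sumFrom-window 1 d (n ∸ d) 0 below inside above ⟩
  sumFrom (1 + d) (n ∸ d) H           ≡⟨ cong (λ x → sumFrom x (n ∸ d) H) (+-comm 1 d) ⟩
  sumFrom (d + 1) (n ∸ d) H           ≡⟨ sumFrom-+ˡ d 1 (n ∸ d) H ⟩
  sumFrom 1 (n ∸ d) (λ b → H (d + b)) ∎
  where
  open ≡-Reasoning
  F : ℕ → ℕ
  F a = 𝟙 (d <? a) * H a
  n≡ : d + (n ∸ d) + 0 ≡ n
  n≡ = trans (+-identityʳ _) (m+[n∸m]≡n d≤n)
  below : ∀ t → t < 1 + d → F t ≡ 0
  below t t<1+d = cong (_* H t) (𝟙-no (λ d<t → <⇒≱ d<t (≤-pred t<1+d)) (d <? t))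
  inside : ∀ t → 1 + d ≤ t → t < 1 + d + (n ∸ d) → F t ≡ H t
  inside t d<t _ = trans (cong (_* H t) (𝟙-yes d<t (d <? t))) (+-identityʳ (H t))
  above : ∀ t → 1 + d + (n ∸ d) ≤ t → t < 1 + d + (n ∸ d) + 0 → F t ≡ 0
  above t p q = ⊥-elim (<⇒≱ q (subst (_≤ t) (sym (+-identityʳ _)) p))
... | no d≰n rewrite m≤n⇒m∸n≡0 (<⇒≤ (≰⇒> d≰n)) =
  sumFrom-zero 1 n
    (λ t _ t<1+n → cong (_* H t) (𝟙-no (λ d<t → d≰n (≤-trans (<⇒≤ d<t) (≤-pred t<1+n))) (d <? t)))

sumOver-seqs-shift : ∀ len n d (q : List ℕ → ℕ) →
  sumOver (λ v → 𝟙 (all? (d <?_) v) * q v) (seqs len n) ≡ sumOver (λ z → q (map (d +_) z)) (seqs len (n ∸ d))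
sumOver-seqs-shift zero      n d q = cong (_+ 0) (+-identityʳ (q []))
sumOver-seqs-shift (suc len) n d q = begin
  sumOver (λ v → 𝟙 (all? (d <?_) v) * q v) (seqs (suc len) n)
    ≡⟨ sumOver-seqs-suc _ len n ⟩
  sumFrom 1 n (λ a → sumOver (λ v → 𝟙 (all? (d <?_) (a ∷ v)) * q (a ∷ v)) (seqs len n))
    ≡⟨ sumFrom-cong 1 n (λ a _ _ → peel a) ⟩
  sumFrom 1 n (λ a → 𝟙 (d <? a) * sumOver (λ z → q (a ∷ map (d +_) z)) (seqs len (n ∸ d)))
    ≡⟨ sumFrom-𝟙< d n _ ⟩
  sumFrom 1 (n ∸ d) (λ b → sumOver (λ z → q (d + b ∷ map (d +_) z)) (seqs len (n ∸ d)))
    ≡⟨ sumOver-seqs-suc _ len (n ∸ d) ⟨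
  sumOver (λ z → q (map (d +_) z)) (seqs (suc len) (n ∸ d))
    ∎
  where
  open ≡-Reasoning
  peel : ∀ a → sumOver (λ v → 𝟙 (all? (d <?_) (a ∷ v)) * q (a ∷ v)) (seqs len n)
             ≡ 𝟙 (d <? a) * sumOver (λ z → q (a ∷ map (d +_) z)) (seqs len (n ∸ d))
  peel a = begin
    sumOver (λ v → 𝟙 (all? (d <?_) (a ∷ v)) * q (a ∷ v)) (seqs len n)
      ≡⟨ sumOver-cong (λ v → trans (cong (_* q (a ∷ v)) (𝟙-all-∷ d a v)) (*-assoc (𝟙 (d <? a)) _ _))
                      (seqs len n) ⟩
    sumOver (λ v → 𝟙 (d <? a) * (𝟙 (all? (d <?_) v) * q (a ∷ v))) (seqs len n)
      ≡⟨ sumOver-*ˡ _ (𝟙 (d <? a)) (seqs len n) ⟩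
    𝟙 (d <? a) * sumOver (λ v → 𝟙 (all? (d <?_) v) * q (a ∷ v)) (seqs len n)
      ≡⟨ cong (𝟙 (d <? a) *_) (sumOver-seqs-shift len n d (λ v → q (a ∷ v))) ⟩
    𝟙 (d <? a) * sumOver (λ z → q (a ∷ map (d +_) z)) (seqs len (n ∸ d))
      ∎

map-+-∸ : ∀ d v → All (d ≤_) v → map (d +_) (map (_∸ d) v) ≡ v
map-+-∸ d []      []           = refl
map-+-∸ d (x ∷ v) (d≤x ∷ d≤v) = cong₂ _∷_ (m+[n∸m]≡n d≤x) (map-+-∸ d v d≤v)

map-∸-+ : ∀ d z → map (_∸ d) (map (d +_) z) ≡ z
map-∸-+ d []      = refl
map-∸-+ d (x ∷ z) = cong₂ _∷_ (m+n∸m≡n d x) (map-∸-+ d z)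

sumOver-seqs-above : ∀ len n d (f : List ℕ → ℕ) →
  sumOver (λ v → 𝟙 (all? (d <?_) v) * f (map (_∸ d) v)) (seqs len n) ≡ sumOver f (seqs len (n ∸ d))
sumOver-seqs-above len n d f = trans (sumOver-seqs-shift len n d (f ∘ map (_∸ d)))
                                      (sumOver-cong (λ z → cong f (map-∸-+ d z)) (seqs len (n ∸ d)))

-- Ballot and Catalan numbers

mutual
  ballot : ℕ → ℕ → ℕ
  ballot zero    D = 1
  ballot (suc t) D = ballotSum t D

  ballotSum : ℕ → ℕ → ℕ
  ballotSum t zero    = ballot t 1
  ballotSum t (suc D) = ballot t (suc (suc D)) + ballotSum t D

-- N C (s ∸ 1), except that it is 0 (not N C 0) for s = 0
_C⁻_ : ℕ → ℕ → ℕ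
N C⁻ zero  = 0
N C⁻ suc s = N C s

nC0≡1 : ∀ n → n C 0 ≡ 1
nC0≡1 n = trans (nCk≡nC[n∸k] {0} {n} z≤n) (nCn≡1 n)

pascal⁻ : ∀ N s → N C⁻ s + N C s ≡ suc N C s
pascal⁻ N zero    = trans (nC0≡1 N) (sym (nC0≡1 (suc N)))
pascal⁻ N (suc s) = pascal N s

C-sym : ∀ {n} k j → k + j ≡ n → n C k ≡ n C j
C-sym {n} k j k+j≡n = begin
  n C k           ≡⟨ nCk≡nC[n∸k] (subst (k ≤_) k+j≡n (m≤m+n k j)) ⟩
  n C (n ∸ k)     ≡⟨ cong (λ x → n C (x ∸ k)) (sym k+j≡n) ⟩
  n C (k + j ∸ k) ≡⟨ cong (n C_) (m+n∸m≡n k j) ⟩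
  n C j           ∎
  where open ≡-Reasoning

C-absorb : ∀ n k → suc k * (suc n C suc k) ≡ suc n * (n C k)
C-absorb zero    zero    = refl
C-absorb zero    (suc k)
  rewrite k>n⇒nCk≡0 {1} {suc (suc k)} (s≤s (s≤s z≤n)) | k>n⇒nCk≡0 {0} {suc k} (s≤s z≤n) = *-zeroʳ k
C-absorb (suc n) zero
  rewrite nC1≡n (suc (suc n)) | nC0≡1 (suc n) = trans (+-identityʳ _) (sym (*-identityʳ _))
C-absorb (suc n) (suc k) = begin
  suc (suc k) * (suc (suc n) C suc (suc k))       ≡⟨ cong (suc (suc k) *_) (pascal (suc n) (suc k)) ⟨
  suc (suc k) * (A + B)                           ≡⟨ *-distribˡ-+ (suc (suc k)) A B ⟩
  A + suc k * A + suc (suc k) * B                 ≡⟨ cong₂ (λ x y → A + x + y) (C-absorb n k) (C-absorb n (suc k)) ⟩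
  A + suc n * (n C k) + suc n * (n C suc k)       ≡⟨ +-assoc A _ _ ⟩
  A + (suc n * (n C k) + suc n * (n C suc k))     ≡⟨ cong (A +_) (*-distribˡ-+ (suc n) (n C k) (n C suc k)) ⟨
  A + suc n * (n C k + n C suc k)                 ≡⟨ cong (λ x → A + suc n * x) (pascal n k) ⟩
  A + suc n * A                                   ∎
  where
  open ≡-Reasoning
  A = suc n C suc k
  B = suc n C suc (suc k)

mutual
  ballot-binomial : ∀ t D → ballot t D + (t + t + D) C⁻ t ≡ (t + t + D) C t
  ballot-binomial zero    D = trans (+-identityʳ 1) (sym (nC0≡1 D))
  ballot-binomial (suc s) D =
    subst (λ N → ballotSum s D + N C s ≡ N C suc s) (sym (double-suc s D)) (ballotSum-binomial s D)

  ballotSum-binomial : ∀ s D →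
    ballotSum s D + (s + s + suc (suc D)) C s ≡ (s + s + suc (suc D)) C suc s
  ballotSum-binomial s zero rewrite +-suc (s + s) 1 = begin
    ballot s 1 + suc M C s                ≡⟨ cong (ballot s 1 +_) (pascal⁻ M s) ⟨
    ballot s 1 + (M C⁻ s + M C s)         ≡⟨ +-assoc (ballot s 1) _ _ ⟨
    ballot s 1 + M C⁻ s + M C s           ≡⟨ cong (_+ M C s) (ballot-binomial s 1) ⟩
    M C s + M C s                         ≡⟨ cong (M C s +_) (C-sym s (suc s) (trans (+-suc s s) (+-comm 1 (s + s)))) ⟩
    M C s + M C suc s                     ≡⟨ pascal M s ⟩
    suc M C suc s                         ∎
    where
    open ≡-Reasoning
    M = s + s + 1
  ballotSum-binomial s (suc D) rewrite +-suc (s + s) (suc (suc D)) = begin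
    ballot s (2 + D) + ballotSum s D + suc N C s
      ≡⟨ cong (ballot s (2 + D) + ballotSum s D +_) (pascal⁻ N s) ⟨
    ballot s (2 + D) + ballotSum s D + (N C⁻ s + N C s)
      ≡⟨ interchange (ballot s (2 + D)) (ballotSum s D) (N C⁻ s) (N C s) ⟩
    (ballot s (2 + D) + N C⁻ s) + (ballotSum s D + N C s)
      ≡⟨ cong₂ _+_ (ballot-binomial s (2 + D)) (ballotSum-binomial s D) ⟩
    N C s + N C suc s
      ≡⟨ pascal N s ⟩
    suc N C suc s
      ∎
    where
    open ≡-Reasoning
    N = s + s + suc (suc D)

  double-suc : ∀ s D → suc s + suc s + D ≡ s + s + suc (suc D)
  double-suc = solve-∀

catalan≡ballot : ∀ i → catalan i ≡ ballot i 0
catalan≡ballot zero    = refl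
catalan≡ballot (suc s) = begin
  catalan i                    ≡⟨ cong (λ x → (x C i) / suc i) (two* i) ⟩
  (X C i) / suc i              ≡⟨ cong (_/ suc i) ballot*suc ⟨
  (ballot i 0 * suc i) / suc i ≡⟨ m*n/n≡m (ballot i 0) (suc i) ⟩
  ballot i 0                   ∎
  where
  open ≡-Reasoning
  i = suc s
  X = i + i + 0
  two* : ∀ i → 2 * i ≡ i + i + 0
  two* = solve-∀
  X≡ : X ≡ suc (s + suc s)
  X≡ = +-identityʳ _
  absorbed : i * (X C i) ≡ suc i * (X C s)
  absorbed = begin
    i * (X C i)                       ≡⟨ cong (λ y → i * (y C i)) X≡ ⟩
    i * (suc (s + i) C i)             ≡⟨ C-absorb (s + i) s ⟩
    suc (s + i) * ((s + i) C s)       ≡⟨ cong (suc (s + i) *_) (C-sym s i refl) ⟩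
    suc (s + i) * ((s + i) C i)       ≡⟨ C-absorb (s + i) i ⟨
    suc i * (suc (s + i) C suc i)     ≡⟨ cong (suc i *_) (C-sym (suc i) s (cong suc (+-comm i s))) ⟩
    suc i * (suc (s + i) C s)         ≡⟨ cong (λ y → suc i * (y C s)) X≡ ⟨
    suc i * (X C s)                   ∎
  ballot*suc : ballot i 0 * suc i ≡ X C i
  ballot*suc = +-cancelʳ-≡ (suc i * (X C s)) _ _ (begin
    ballot i 0 * suc i + suc i * (X C s)   ≡⟨ cong (_+ suc i * (X C s)) (*-comm (ballot i 0) (suc i)) ⟩
    suc i * ballot i 0 + suc i * (X C s)   ≡⟨ *-distribˡ-+ (suc i) (ballot i 0) (X C s) ⟨
    suc i * (ballot i 0 + X C s)           ≡⟨ cong (suc i *_) (ballot-binomial i 0) ⟩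
    suc i * (X C i)                        ≡⟨ cong (X C i +_) absorbed ⟩
    X C i + suc i * (X C s)                ∎)

Block : ℕ → ℕ → List ℕ → Set
Block lo cap []      = ⊤
Block lo cap (x ∷ u) = (lo ≤ x × x ≤ cap) × Block x (suc cap) u

block? : ∀ lo cap u → Dec (Block lo cap u)
block? lo cap []      = yes tt
block? lo cap (x ∷ u) = ((lo ≤? x) ×-dec (x ≤? cap)) ×-dec block? x (suc cap) u

sumFrom-𝟙-between : ∀ lo cap n (G : ℕ → ℕ) → lo ≤ cap → cap ≤ n →
  sumFrom 1 n (λ a → 𝟙 ((suc lo ≤? a) ×-dec (a ≤? cap)) * G a) ≡ sumFrom (suc lo) (cap ∸ lo) G
sumFrom-𝟙-between lo cap n G lo≤cap cap≤n = begin
  sumFrom 1 n F                             ≡⟨ cong (λ x → sumFrom 1 x F) n≡ ⟨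
  sumFrom 1 (lo + (cap ∸ lo) + (n ∸ cap)) F ≡⟨ sumFrom-window 1 lo (cap ∸ lo) (n ∸ cap) below inside above ⟩
  sumFrom (suc lo) (cap ∸ lo) G             ∎
  where
  open ≡-Reasoning
  window? : ∀ a → Dec (suc lo ≤ a × a ≤ cap)
  window? a = (suc lo ≤? a) ×-dec (a ≤? cap)
  F : ℕ → ℕ
  F a = 𝟙 (window? a) * G a
  n≡ : lo + (cap ∸ lo) + (n ∸ cap) ≡ n
  n≡ = trans (cong (_+ (n ∸ cap)) (m+[n∸m]≡n lo≤cap)) (m+[n∸m]≡n cap≤n)
  end≡ : suc lo + (cap ∸ lo) ≡ suc cap
  end≡ = cong suc (m+[n∸m]≡n lo≤cap)
  below : ∀ t → t < suc lo → F t ≡ 0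
  below t t≤lo = cong (_* G t) (𝟙-no (λ (lo<t , _) → <⇒≱ lo<t (≤-pred t≤lo)) (window? t))
  inside : ∀ t → suc lo ≤ t → t < suc lo + (cap ∸ lo) → F t ≡ G t
  inside t lo<t t<end =
    trans (cong (_* G t) (𝟙-yes (lo<t , ≤-pred (subst (t <_) end≡ t<end)) (window? t))) (+-identityʳ (G t))
  above : ∀ t → suc lo + (cap ∸ lo) ≤ t → t < suc lo + (cap ∸ lo) + (n ∸ cap) → F t ≡ 0
  above t end≤t _ =
    cong (_* G t) (𝟙-no (λ (_ , t≤cap) → <⇒≱ (subst (_≤ t) end≡ end≤t) t≤cap) (window? t))

ballotSum-as-sumFrom : ∀ t lo D → sumFrom lo (suc D) (λ a → ballot t (suc (lo + D) ∸ a)) ≡ ballotSum t D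
ballotSum-as-sumFrom t lo zero rewrite +-identityʳ lo =
  trans (+-identityʳ _) (cong (ballot t) (m+n∸n≡m 1 lo))
ballotSum-as-sumFrom t lo (suc D) = cong₂ _+_
  (cong (ballot t) (trans (cong (_∸ lo) (sym (+-suc lo (suc D)))) (m+n∸m≡n lo (suc (suc D)))))
  (trans (sumFrom-cong (suc lo) (suc D) (λ a _ _ → cong (λ x → ballot t (suc x ∸ a)) (+-suc lo D)))
         (ballotSum-as-sumFrom t (suc lo) D))

-- Choosing the first entry a ∈ [lo, cap] leaves a block of slack (cap + 1) − a.
blockCount : ∀ t n lo cap → 1 ≤ lo → lo ≤ cap → cap + t ≤ suc n →
             sumOver (𝟙 ∘ block? lo cap) (seqs t n) ≡ ballot t (cap ∸ lo)
blockCount zero    n lo       cap _ _ _ = refl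
blockCount (suc t) n (suc lo) cap _ lo<cap bound = begin
  sumOver (𝟙 ∘ block? (suc lo) cap) (seqs (suc t) n)
    ≡⟨ sumOver-seqs-suc _ t n ⟩
  sumFrom 1 n (λ a → sumOver (λ u → 𝟙 (block? (suc lo) cap (a ∷ u))) (seqs t n))
    ≡⟨ sumFrom-cong 1 n (λ a _ _ → firstEntry a) ⟩
  sumFrom 1 n (λ a → 𝟙 (window? a) * ballot t (suc cap ∸ a))
    ≡⟨ sumFrom-𝟙-between lo cap n _ (<⇒≤ lo<cap) cap≤n ⟩
  sumFrom (suc lo) (cap ∸ lo) (λ a → ballot t (suc cap ∸ a))
    ≡⟨ cong (λ x → sumFrom (suc lo) x (λ a → ballot t (suc cap ∸ a))) (+-∸-assoc 1 lo<cap) ⟩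
  sumFrom (suc lo) (suc (cap ∸ suc lo)) (λ a → ballot t (suc cap ∸ a))
    ≡⟨ cong (λ x → sumFrom (suc lo) (suc (cap ∸ suc lo)) (λ a → ballot t (suc x ∸ a))) (m+[n∸m]≡n lo<cap) ⟨
  sumFrom (suc lo) (suc (cap ∸ suc lo)) (λ a → ballot t (suc (suc lo + (cap ∸ suc lo)) ∸ a))
    ≡⟨ ballotSum-as-sumFrom t (suc lo) (cap ∸ suc lo) ⟩
  ballot (suc t) (cap ∸ suc lo)
    ∎
  where
  open ≡-Reasoning
  window? : ∀ a → Dec (suc lo ≤ a × a ≤ cap)
  window? a = (suc lo ≤? a) ×-dec (a ≤? cap)
  cap≤n : cap ≤ n
  cap≤n = ≤-pred (≤-trans (s≤s (m≤m+n cap t)) (subst (_≤ suc n) (+-suc cap t) bound))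
  firstEntry : ∀ a → sumOver (λ u → 𝟙 (block? (suc lo) cap (a ∷ u))) (seqs t n)
                   ≡ 𝟙 (window? a) * ballot t (suc cap ∸ a)
  firstEntry a = begin
    sumOver (λ u → 𝟙 (block? (suc lo) cap (a ∷ u))) (seqs t n)
      ≡⟨ sumOver-cong (λ u → 𝟙-× (window? a) (block? a (suc cap) u)) (seqs t n) ⟩
    sumOver (λ u → 𝟙 (window? a) * 𝟙 (block? a (suc cap) u)) (seqs t n)
      ≡⟨ sumOver-*ˡ (𝟙 ∘ block? a (suc cap)) (𝟙 (window? a)) (seqs t n) ⟩
    𝟙 (window? a) * sumOver (𝟙 ∘ block? a (suc cap)) (seqs t n)
      ≡⟨ 𝟙-*-cong (window? a) (λ (lo<a , a≤cap) → blockCount t n a (suc cap) (≤-trans (s≤s z≤n) lo<a)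
                                                    (m≤n⇒m≤1+n a≤cap) (subst (_≤ suc n) (+-suc cap t) bound)) ⟩
    𝟙 (window? a) * ballot t (suc cap ∸ a)
      ∎

-- Parking

length-emptyStreet : ∀ n → length (emptyStreet n) ≡ n
length-emptyStreet zero    = refl
length-emptyStreet (suc n) = cong suc (length-emptyStreet n)

emptyStreet-+ : ∀ a b → emptyStreet (a + b) ≡ emptyStreet a ++ emptyStreet b
emptyStreet-+ zero    b = refl
emptyStreet-+ (suc a) b = cong (false ∷_) (emptyStreet-+ a b)

emptyStreet-split : ∀ {d n} → d ≤ n → emptyStreet n ≡ emptyStreet d ++ emptyStreet (n ∸ d)
emptyStreet-split {d} {n} d≤n = trans (cong emptyStreet (sym (m+[n∸m]≡n d≤n))) (emptyStreet-+ d (n ∸ d))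

tryPark-++ : ∀ pre st x → length pre < x →
             tryPark x (pre ++ st) ≡ map₂ (pre ++_) (tryPark (x ∸ length pre) st)
tryPark-++ []        st x             _        = refl
tryPark-++ (b ∷ pre) st (suc zero)    (s≤s ())
tryPark-++ (b ∷ pre) st (suc (suc x)) (s≤s lt) rewrite tryPark-++ pre st (suc x) lt = refl

flawsFrom-++ : ∀ pre {d} st w → length pre ≡ d → All (d <_) w →
               flawsFrom w (pre ++ st) ≡ flawsFrom (map (_∸ d) w) st
flawsFrom-++ pre st []      refl []       = refl
flawsFrom-++ pre st (a ∷ w) refl (p ∷ ps) rewrite tryPark-++ pre st a p with tryPark (a ∸ length pre) st
... | true  , st′ = flawsFrom-++ pre st′ w refl ps
... | false , st′ = cong suc (flawsFrom-++ pre st′ w refl ps)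

flaws-shift : ∀ N d w → d ≤ N → All (d <_) w → flaws N w ≡ flaws (N ∸ d) (map (_∸ d) w)
flaws-shift N d w d≤N d<w = trans (cong (flawsFrom w) (emptyStreet-split d≤N))
                                  (flawsFrom-++ (emptyStreet d) _ w (length-emptyStreet d) d<w)

tryPark-run : ∀ t y E → 1 ≤ y → y ≤ suc t →
  tryPark y (replicate t true ++ (false ∷ E)) ≡ (true , true ∷ replicate t true ++ E)
tryPark-run zero    (suc zero)    E _ _ = refl
tryPark-run zero    (suc (suc y)) E _ (s≤s ())
tryPark-run (suc t) (suc zero)    E _ _ rewrite tryPark-run t 1 E (s≤s z≤n) (s≤s z≤n) = refl
tryPark-run (suc t) (suc (suc y)) E _ (s≤s y≤t) rewrite tryPark-run t (suc y) E (s≤s z≤n) y≤t = refl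

tryPark-afterGap : ∀ m′ t E x → m′ < x → x ≤ suc m′ + t →
  tryPark x (emptyStreet m′ ++ (replicate t true ++ (false ∷ E)))
  ≡ (true , emptyStreet m′ ++ (true ∷ replicate t true ++ E))
tryPark-afterGap m′ t E x m′<x x≤ = begin
  tryPark x (gap ++ run)
    ≡⟨ tryPark-++ gap run x (subst (_< x) (sym (length-emptyStreet m′)) m′<x) ⟩
  map₂ (gap ++_) (tryPark (x ∸ length gap) run)
    ≡⟨ cong (λ e → map₂ (gap ++_) (tryPark (x ∸ e) run)) (length-emptyStreet m′) ⟩
  map₂ (gap ++_) (tryPark (x ∸ m′) run)
    ≡⟨ cong (map₂ (gap ++_)) (tryPark-run t (x ∸ m′) E 1≤y y≤) ⟩
  (true , gap ++ (true ∷ replicate t true ++ E))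
    ∎
  where
  open ≡-Reasoning
  gap = emptyStreet m′
  run = replicate t true ++ (false ∷ E)
  1≤y : 1 ≤ x ∸ m′
  1≤y = subst (_≤ x ∸ m′) (m+n∸m≡n m′ 1) (∸-monoˡ-≤ m′ (subst (_≤ x) (+-comm 1 m′) m′<x))
  y≤ : x ∸ m′ ≤ suc t
  y≤ = subst (x ∸ m′ ≤_) (m+n∸m≡n m′ (suc t)) (∸-monoˡ-≤ m′ (subst (x ≤_) (sym (+-suc m′ t)) x≤))

flawsFrom-Block : ∀ m′ t R lo cap u rest →
  Block lo cap u → suc m′ ≤ lo → cap ≡ suc m′ + t → length u ≤ R →
  flawsFrom (u ++ rest) (emptyStreet m′ ++ (replicate t true ++ emptyStreet R))
  ≡ flawsFrom rest (emptyStreet m′ ++ (replicate (t + length u) true ++ emptyStreet (R ∸ length u)))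
flawsFrom-Block m′ t R       lo cap []      rest _ _ _ _ rewrite +-identityʳ t = refl
flawsFrom-Block m′ t (suc R) lo cap (x ∷ u) rest ((lo≤x , x≤cap) , block) m′<lo refl (s≤s ∣u∣≤R)
  with m′<x ← ≤-trans m′<lo lo≤x
  rewrite tryPark-afterGap m′ t (emptyStreet R) x m′<x x≤cap
        | flawsFrom-Block m′ (suc t) R x (suc cap) u rest block m′<x (sym (+-suc (suc m′) t)) ∣u∣≤R
        | +-suc t (length u) = refl

flaws-Block-++ : ∀ n m′ u rest → Block (suc m′) (suc m′) u → m′ ≤ n → length u ≤ n ∸ m′ →
  flaws n (u ++ rest)
  ≡ flawsFrom rest (emptyStreet m′ ++ (replicate (length u) true ++ emptyStreet (n ∸ m′ ∸ length u)))
flaws-Block-++ n m′ u rest block m′≤n ∣u∣≤ =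
  trans (cong (flawsFrom (u ++ rest)) (emptyStreet-split m′≤n))
        (flawsFrom-Block m′ 0 (n ∸ m′) (suc m′) (suc m′) u rest block ≤-refl (sym (+-identityʳ _)) ∣u∣≤)

flawsFrom≤length : ∀ as st → flawsFrom as st ≤ length as
flawsFrom≤length []       st = z≤n
flawsFrom≤length (a ∷ as) st with tryPark a st
... | true  , st′ = m≤n⇒m≤1+n (flawsFrom≤length as st′)
... | false , st′ = s≤s (flawsFrom≤length as st′)

freeSpaces : List Bool → ℕ
freeSpaces []           = 0
freeSpaces (false ∷ bs) = suc (freeSpaces bs)
freeSpaces (true ∷ bs)  = freeSpaces bs

parked : Bool → ℕ
parked true  = 1
parked false = 0

freeSpaces-tryPark : ∀ a st →
  freeSpaces st ≡ parked (proj₁ (tryPark a st)) + freeSpaces (proj₂ (tryPark a st))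
freeSpaces-tryPark a             []           = refl
freeSpaces-tryPark (suc (suc a)) (false ∷ bs) = trans (cong suc (freeSpaces-tryPark (suc a) bs)) (sym (+-suc _ _))
freeSpaces-tryPark (suc (suc a)) (true ∷ bs)  = freeSpaces-tryPark (suc a) bs
freeSpaces-tryPark zero          (false ∷ bs) = refl
freeSpaces-tryPark (suc zero)    (false ∷ bs) = refl
freeSpaces-tryPark zero          (true ∷ bs)  = freeSpaces-tryPark zero bs
freeSpaces-tryPark (suc zero)    (true ∷ bs)  = freeSpaces-tryPark 1 bs

length≤flaws+free : ∀ as st → length as ≤ flawsFrom as st + freeSpaces st
length≤flaws+free []       st = z≤n
length≤flaws+free (a ∷ as) st with tryPark a st | freeSpaces-tryPark a st
... | true  , st′ | free≡ rewrite free≡ =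
  subst (suc (length as) ≤_) (sym (+-suc _ _)) (s≤s (length≤flaws+free as st′))
... | false , st′ | free≡ rewrite free≡ = s≤s (length≤flaws+free as st′)

freeSpaces-emptyStreet : ∀ n → freeSpaces (emptyStreet n) ≡ n
freeSpaces-emptyStreet zero    = refl
freeSpaces-emptyStreet (suc n) = cong suc (freeSpaces-emptyStreet n)

-- For an ordered preference set with leading term m, the first blockLength m cars park in the
-- consecutive spaces m, m + 1, …, and the next car prefers a space beyond them.
blockLength : ℕ → List ℕ → ℕ
blockLength cap []       = 0
blockLength cap (x ∷ xs) with x ≤? cap
... | yes _ = suc (blockLength (suc cap) xs)
... | no _  = 0

1≤blockLength : ∀ m as → 1 ≤ blockLength m (m ∷ as)
1≤blockLength m as with m ≤? m
... | yes _ = s≤s z≤n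
... | no m≰m = ⊥-elim (m≰m ≤-refl)

blockLength-∷≡0⇒< : ∀ cap x v → blockLength cap (x ∷ v) ≡ 0 → cap < x
blockLength-∷≡0⇒< cap x v _ with x ≤? cap
blockLength-∷≡0⇒< cap x v () | yes _
... | no x≰cap = ≰⇒> x≰cap

<⇒blockLength-∷≡0 : ∀ cap x v → cap < x → blockLength cap (x ∷ v) ≡ 0
<⇒blockLength-∷≡0 cap x v cap<x with x ≤? cap
... | yes x≤cap = ⊥-elim (<⇒≱ cap<x x≤cap)
... | no _      = refl

blockLength-Block-++ : ∀ lo cap u v → Block lo cap u →
                       blockLength cap (u ++ v) ≡ length u + blockLength (cap + length u) v
blockLength-Block-++ lo cap []      v _ = cong (λ c → blockLength c v) (sym (+-identityʳ cap))
blockLength-Block-++ lo cap (x ∷ u) v ((_ , x≤cap) , block) with x ≤? cap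
... | no x≰cap = ⊥-elim (x≰cap x≤cap)
... | yes _    = cong suc (trans (blockLength-Block-++ x (suc cap) u v block)
                                 (cong (λ c → length u + blockLength c v) (sym (+-suc cap (length u)))))

Block-take : ∀ j lo cap xs → Ordered (lo ∷ xs) → j ≤ blockLength cap xs → Block lo cap (take j xs)
Block-take zero    lo cap xs       _ _ = tt
Block-take (suc j) lo cap []       _      ()
Block-take (suc j) lo cap (x ∷ xs) sorted j<bl with x ≤? cap
... | yes x≤cap = (Linked.head sorted , x≤cap) , Block-take j x (suc cap) xs (Linked.tail sorted) (≤-pred j<bl)
Block-take (suc j) lo cap (x ∷ xs) sorted () | no _

take-length-++ : ∀ (u v : List ℕ) → take (length u) (u ++ v) ≡ u
take-length-++ []      v = refl
take-length-++ (x ∷ u) v = cong (x ∷_) (take-length-++ u v)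

Ordered-++⁻ʳ : ∀ u v → Ordered (u ++ v) → Ordered v
Ordered-++⁻ʳ []      v sorted = sorted
Ordered-++⁻ʳ (x ∷ u) v sorted = Ordered-++⁻ʳ u v (Linked.tail sorted)

Ordered-Block-++ : ∀ lo cap u v → lo ≤ cap → Block lo cap u → All (cap + length u ≤_) v → Ordered v →
                   Ordered (lo ∷ u ++ v)
Ordered-Block-++ lo cap []      []      _      _ _           _      = [-]
Ordered-Block-++ lo cap []      (y ∷ v) lo≤cap _ (cap≤y ∷ _) sorted =
  ≤-trans lo≤cap (≤-trans (m≤m+n cap 0) cap≤y) ∷ sorted
Ordered-Block-++ lo cap (x ∷ u) v       _      ((lo≤x , x≤cap) , block) bound sorted =
  lo≤x ∷ Ordered-Block-++ x (suc cap) u v (m≤n⇒m≤1+n x≤cap) block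
                          (All.map (≤-trans (≤-reflexive (sym (+-suc cap (length u))))) bound) sorted

Ordered-map-∸ : ∀ d {v} → Ordered v → Ordered (map (_∸ d) v)
Ordered-map-∸ d = SortedProperties.map⁺ ≤-totalOrder ≤-totalOrder (∸-monoˡ-≤ d)

Ordered-map-+ : ∀ d {v} → Ordered v → Ordered (map (d +_) v)
Ordered-map-+ d = SortedProperties.map⁺ ≤-totalOrder ≤-totalOrder (+-monoʳ-≤ d)

Ordered⇒All-< : ∀ {d y v} → d < y → Ordered (y ∷ v) → All (d <_) (y ∷ v)
Ordered⇒All-< = LinkedProperties.Linked⇒All ≤-trans

maxEntry-++ : ∀ u v → maxEntry (u ++ v) ≡ maxEntry u ⊔ maxEntry v
maxEntry-++ []      v = refl
maxEntry-++ (x ∷ u) v = trans (cong (x ⊔_) (maxEntry-++ u v)) (sym (⊔-assoc x (maxEntry u) (maxEntry v)))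

maxEntry-map-+ : ∀ d a z → maxEntry (map (d +_) (a ∷ z)) ≡ d + maxEntry (a ∷ z)
maxEntry-map-+ d a []      = trans (⊔-identityʳ (d + a)) (cong (d +_) (sym (⊔-identityʳ a)))
maxEntry-map-+ d a (b ∷ z) =
  trans (cong ((d + a) ⊔_) (maxEntry-map-+ d b z)) (sym (+-distribˡ-⊔ d a (maxEntry (b ∷ z))))

maxEntry-shift : ∀ d y v → All (d ≤_) (y ∷ v) → maxEntry (y ∷ v) ≡ d + maxEntry (map (_∸ d) (y ∷ v))
maxEntry-shift d y v d≤yv =
  trans (cong maxEntry (sym (map-+-∸ d (y ∷ v) d≤yv))) (maxEntry-map-+ d (y ∸ d) (map (_∸ d) v))

maxEntry-Block : ∀ lo cap u → Block lo cap u → maxEntry u ≤ cap + length u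
maxEntry-Block lo cap []      _ = z≤n
maxEntry-Block lo cap (x ∷ u) ((_ , x≤cap) , block) =
  ⊔-lub (≤-trans x≤cap (m≤m+n cap (suc (length u))))
        (≤-trans (maxEntry-Block x (suc cap) u block) (≤-reflexive (sym (+-suc cap (length u)))))

-- All cars prefer a space ≥ h, so at most the N + 1 − h spaces h, …, N can be filled.
head≤flaws+1 : ∀ N h w → Ordered (h ∷ w) → length (h ∷ w) ≡ N → h ≤ N → h ≤ suc (flaws N (h ∷ w))
head≤flaws+1 N zero     w _      _       _   = z≤n
head≤flaws+1 N (suc h′) w sorted ∣hw∣≡N h<N = s≤s (+-cancelʳ-≤ (N ∸ h′) h′ _ (begin
  h′ + (N ∸ h′)
    ≡⟨ m+[n∸m]≡n h′≤N ⟩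
  N
    ≡⟨ trans (sym ∣hw∣≡N) (sym (length-map (_∸ h′) (suc h′ ∷ w))) ⟩
  length z
    ≤⟨ length≤flaws+free z (emptyStreet (N ∸ h′)) ⟩
  flaws (N ∸ h′) z + freeSpaces (emptyStreet (N ∸ h′))
    ≡⟨ cong₂ _+_ (sym (flaws-shift N h′ (suc h′ ∷ w) h′≤N (Ordered⇒All-< ≤-refl sorted)))
                 (freeSpaces-emptyStreet (N ∸ h′)) ⟩
  flaws N (suc h′ ∷ w) + (N ∸ h′)
    ∎))
  where
  open ≤-Reasoning
  z = map (_∸ h′) (suc h′ ∷ w)
  h′≤N : h′ ≤ N
  h′≤N = <⇒≤ h<N

-- Decomposition by the length of the initial block

ordered? : ∀ z → Dec (Ordered z)
ordered? = Sorted.sorted? ≤-totalOrder _≤?_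

-- The cars behind the initial block, shifted down by d so that they prefer spaces 1, …, N.
Tail : (N k d l : ℕ) → List ℕ → Set
Tail N k d l z = Ordered z × flaws N z ≡ k × d + maxEntry z ≡ l

tail? : ∀ N k d l z → Dec (Tail N k d l z)
tail? N k d l z = ordered? z ×-dec (flaws N z ≟ k) ×-dec (d + maxEntry z ≟ l)

module _ {m′ i : ℕ} {u : List ℕ} (block : Block (suc m′) (suc m′) u) (∣u∣≡i : length u ≡ i) where

  private
    d = suc m′ + i

  flaws-Block-Tail : ∀ {n v} → All (d <_) v → d < n → flaws n (u ++ v) ≡ flaws (n ∸ d) (map (_∸ d) v)
  flaws-Block-Tail {n} {v} d<v d<n = begin
    flaws n (u ++ v)
      ≡⟨ flaws-Block-++ n m′ u v block m′≤n ∣u∣≤ ⟩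
    flawsFrom v (gap ++ (replicate (length u) true ++ emptyStreet (n ∸ m′ ∸ length u)))
      ≡⟨ cong (λ j → flawsFrom v (gap ++ (replicate j true ++ emptyStreet (n ∸ m′ ∸ j)))) ∣u∣≡i ⟩
    flawsFrom v (gap ++ (replicate i true ++ emptyStreet (n ∸ m′ ∸ i)))
      ≡⟨ cong (λ j → flawsFrom v (gap ++ (replicate i true ++ emptyStreet j))) rest≡ ⟩
    flawsFrom v (gap ++ (replicate i true ++ (false ∷ emptyStreet (n ∸ d))))
      ≡⟨ cong (flawsFrom v) street≡ ⟩
    flawsFrom v (occupied ++ emptyStreet (n ∸ d))
      ≡⟨ flawsFrom-++ occupied _ v ∣occupied∣ d<v ⟩
    flaws (n ∸ d) (map (_∸ d) v)
      ∎
    where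
    open ≡-Reasoning
    gap = emptyStreet m′
    occupied = gap ++ replicate i true ++ false ∷ []
    m′≤n : m′ ≤ n
    m′≤n = ≤-trans (m≤m+n m′ i) (<⇒≤ (<-trans (n<1+n (m′ + i)) d<n))
    ∣u∣≤ : length u ≤ n ∸ m′
    ∣u∣≤ = subst (_≤ n ∸ m′) (trans (m+n∸m≡n m′ i) (sym ∣u∣≡i))
                 (∸-monoˡ-≤ m′ (≤-trans (n≤1+n (m′ + i)) (<⇒≤ d<n)))
    rest≡ : n ∸ m′ ∸ i ≡ suc (n ∸ d)
    rest≡ = trans (∸-+-assoc n m′ i) (+-∸-assoc 1 (<⇒≤ d<n))
    street≡ : gap ++ (replicate i true ++ (false ∷ emptyStreet (n ∸ d))) ≡ occupied ++ emptyStreet (n ∸ d)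
    street≡ = sym (trans (++-assoc gap (replicate i true ++ false ∷ []) _)
                         (cong (gap ++_) (++-assoc (replicate i true) (false ∷ []) _)))
    ∣occupied∣ : length occupied ≡ d
    ∣occupied∣ = begin
      length occupied
        ≡⟨ length-++ gap ⟩
      length gap + length (replicate i true ++ false ∷ [])
        ≡⟨ cong₂ _+_ (length-emptyStreet m′) (length-++ (replicate i true)) ⟩
      m′ + (length (replicate i true) + 1)
        ≡⟨ cong (λ j → m′ + (j + 1)) (length-replicate i) ⟩
      m′ + (i + 1)
        ≡⟨ cong (m′ +_) (+-comm i 1) ⟩
      m′ + suc i
        ≡⟨ +-suc m′ i ⟩
      d
        ∎

  maxEntry-Block-Tail : ∀ {y v} → All (d <_) (y ∷ v) → maxEntry (u ++ y ∷ v) ≡ d + maxEntry (map (_∸ d) (y ∷ v))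
  maxEntry-Block-Tail {y} {v} d<yv@(d<y ∷ _) = begin
    maxEntry (u ++ y ∷ v)             ≡⟨ maxEntry-++ u (y ∷ v) ⟩
    maxEntry u ⊔ maxEntry (y ∷ v)     ≡⟨ m≤n⇒m⊔n≡n u≤yv ⟩
    maxEntry (y ∷ v)                  ≡⟨ maxEntry-shift d y v (All.map <⇒≤ d<yv) ⟩
    d + maxEntry (map (_∸ d) (y ∷ v)) ∎
    where
    open ≡-Reasoning
    u≤yv : maxEntry u ≤ maxEntry (y ∷ v)
    u≤yv = ≤-trans (maxEntry-Block _ _ u block) (≤-trans (≤-reflexive (cong (suc m′ +_) ∣u∣≡i))
             (≤-trans (<⇒≤ d<y) (m≤m⊔n y (maxEntry v))))

module _ {n k l m′ i x y : ℕ} {u v : List ℕ} (∣xu∣≡i : length (x ∷ u) ≡ i) (y≤n : y ≤ n) where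

  private
    m = suc m′
    d = m + i
    U = x ∷ u
    V = y ∷ v

  split-OpProp : OpProp n k l m (U ++ V) × blockLength m (U ++ V) ≡ i →
                 Block m m U × All (d <_) V × Tail (n ∸ d) k d l (map (_∸ d) V)
  split-OpProp ((sorted , flaws≡k , refl , max≡l) , bl≡i) =
    block , d<V , Ordered-map-∸ d sortedV
          , trans (sym (flaws-Block-Tail block ∣xu∣≡i d<V (<-≤-trans d<y y≤n))) flaws≡k
          , trans (sym (maxEntry-Block-Tail block ∣xu∣≡i d<V)) max≡l
    where
    block : Block m m U
    block = subst (Block m m) (trans (cong (λ j → take j (U ++ V)) (sym ∣xu∣≡i)) (take-length-++ U V))
                  (Block-take i m m (U ++ V) (≤-refl ∷ sorted) (≤-reflexive (sym bl≡i)))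
    blV≡0 : blockLength d V ≡ 0
    blV≡0 = +-cancelˡ-≡ (length U) _ 0 (begin
      length U + blockLength d V                ≡⟨ cong (λ j → length U + blockLength (m + j) V) ∣xu∣≡i ⟨
      length U + blockLength (m + length U) V   ≡⟨ blockLength-Block-++ m m U V block ⟨
      blockLength m (U ++ V)                    ≡⟨ trans bl≡i (sym ∣xu∣≡i) ⟩
      length U                                  ≡⟨ +-identityʳ _ ⟨
      length U + 0                              ∎)
      where open ≡-Reasoning
    d<y : d < y
    d<y = blockLength-∷≡0⇒< d y v blV≡0
    sortedV : Ordered V
    sortedV = Ordered-++⁻ʳ U V sorted
    d<V : All (d <_) V
    d<V = Ordered⇒All-< d<y sortedV

  join-OpProp : Block m m U × All (d <_) V × Tail (n ∸ d) k d l (map (_∸ d) V) →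
                OpProp n k l m (U ++ V) × blockLength m (U ++ V) ≡ i
  join-OpProp (block@((m≤x , x≤m) , blocku) , d<V@(d<y ∷ _) , sortedZ , flaws≡k , max≡l) =
    ( sorted
    , trans (flaws-Block-Tail block ∣xu∣≡i d<V (<-≤-trans d<y y≤n)) flaws≡k
    , cong just (≤-antisym x≤m m≤x)
    , trans (maxEntry-Block-Tail block ∣xu∣≡i d<V) max≡l
    ) , bl≡i
    where
    sortedV : Ordered V
    sortedV = subst Ordered (map-+-∸ d V (All.map <⇒≤ d<V)) (Ordered-map-+ d sortedZ)
    d≡ : d ≡ suc m + length u
    d≡ = trans (cong (m +_) (sym ∣xu∣≡i)) (+-suc m (length u))
    sorted : Ordered (U ++ V)
    sorted = Ordered-Block-++ x (suc m) u V (m≤n⇒m≤1+n x≤m) blocku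
                              (All.map (λ d<z → ≤-trans (≤-reflexive (sym d≡)) (<⇒≤ d<z)) d<V) sortedV
    bl≡i : blockLength m (U ++ V) ≡ i
    bl≡i = begin
      blockLength m (U ++ V)                    ≡⟨ blockLength-Block-++ m m U V block ⟩
      length U + blockLength (m + length U) V   ≡⟨ cong (λ j → length U + blockLength (m + j) V) ∣xu∣≡i ⟩
      length U + blockLength d V                ≡⟨ cong (length U +_) (<⇒blockLength-∷≡0 d y v d<y) ⟩
      length U + 0                              ≡⟨ trans (+-identityʳ _) ∣xu∣≡i ⟩
      i                                         ∎
      where open ≡-Reasoning

tailCount : (n k l m i : ℕ) → ℕ
tailCount n k l m i = sumOver (𝟙 ∘ tail? (n ∸ (m + i)) k (m + i) l) (seqs (n ∸ i) (n ∸ (m + i)))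

opWithBlock : (n k l m i : ℕ) → ℕ
opWithBlock n k l m i = sumOver (λ as → 𝟙 (opProp? n k l m as ×-dec (blockLength m as ≟ i))) (seqs n n)

opWithBlock≡blocks*tailCount : ∀ n k l m′ i → 1 ≤ i → i < n →
  opWithBlock n k l (suc m′) i ≡ sumOver (𝟙 ∘ block? (suc m′) (suc m′)) (seqs i n) * tailCount n k l (suc m′) i
opWithBlock≡blocks*tailCount n k l m′ i 1≤i i<n = begin
  sumOver W (seqs n n)
    ≡⟨ cong (λ t → sumOver W (seqs t n)) (m+[n∸m]≡n (<⇒≤ i<n)) ⟨
  sumOver W (seqs (i + (n ∸ i)) n)
    ≡⟨ sumOver-seqs-++ W i (n ∸ i) n ⟩
  sumOver (λ u → sumOver (λ v → W (u ++ v)) (seqs (n ∸ i) n)) (seqs i n)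
    ≡⟨ sumOver-seqs-cong i n (λ u ∣u∣≡i _ → splitAt u ∣u∣≡i) ⟩
  sumOver (λ u → 𝟙 (block? m m u) * tailCount n k l m i) (seqs i n)
    ≡⟨ sumOver-*ʳ (𝟙 ∘ block? m m) _ (seqs i n) ⟩
  sumOver (𝟙 ∘ block? m m) (seqs i n) * tailCount n k l m i
    ∎
  where
  open ≡-Reasoning
  m = suc m′
  d = m + i
  W : List ℕ → ℕ
  W as = 𝟙 (opProp? n k l m as ×-dec (blockLength m as ≟ i))
  T : List ℕ → ℕ
  T = 𝟙 ∘ tail? (n ∸ d) k d l
  W-++ : ∀ u → length u ≡ i → ∀ v → length v ≡ n ∸ i → InRange n v →
         W (u ++ v) ≡ 𝟙 (block? m m u) * (𝟙 (all? (d <?_) v) * T (map (_∸ d) v))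
  W-++ []      ∣u∣≡i _       _         _ = ⊥-elim (<⇒≱ 1≤i (≤-reflexive (sym ∣u∣≡i)))
  W-++ (x ∷ u) ∣u∣≡i []      ∣v∣≡n∸i   _ = ⊥-elim (<⇒≱ i<n (m∸n≡0⇒m≤n (sym ∣v∣≡n∸i)))
  W-++ (x ∷ u) ∣u∣≡i (y ∷ v) _ ((_ , y≤n) ∷ _) = begin
    W ((x ∷ u) ++ y ∷ v)
      ≡⟨ 𝟙-cong (split-OpProp ∣u∣≡i y≤n) (join-OpProp ∣u∣≡i y≤n) _ pieces? ⟩
    𝟙 (block? m m (x ∷ u) ×-dec (all? (d <?_) (y ∷ v) ×-dec tail? (n ∸ d) k d l z))
      ≡⟨ 𝟙-× (block? m m (x ∷ u)) _ ⟩
    𝟙 (block? m m (x ∷ u)) * 𝟙 (all? (d <?_) (y ∷ v) ×-dec tail? (n ∸ d) k d l z)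
      ≡⟨ cong (𝟙 (block? m m (x ∷ u)) *_) (𝟙-× (all? (d <?_) (y ∷ v)) _) ⟩
    𝟙 (block? m m (x ∷ u)) * (𝟙 (all? (d <?_) (y ∷ v)) * T z)
      ∎
    where
    z = map (_∸ d) (y ∷ v)
    pieces? = block? m m (x ∷ u) ×-dec (all? (d <?_) (y ∷ v) ×-dec tail? (n ∸ d) k d l z)
  splitAt : ∀ u → length u ≡ i →
            sumOver (λ v → W (u ++ v)) (seqs (n ∸ i) n) ≡ 𝟙 (block? m m u) * tailCount n k l m i
  splitAt u ∣u∣≡i = begin
    sumOver (λ v → W (u ++ v)) (seqs (n ∸ i) n)
      ≡⟨ sumOver-seqs-cong (n ∸ i) n (W-++ u ∣u∣≡i) ⟩
    sumOver (λ v → 𝟙 (block? m m u) * (𝟙 (all? (d <?_) v) * T (map (_∸ d) v))) (seqs (n ∸ i) n)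
      ≡⟨ sumOver-*ˡ _ (𝟙 (block? m m u)) (seqs (n ∸ i) n) ⟩
    𝟙 (block? m m u) * sumOver (λ v → 𝟙 (all? (d <?_) v) * T (map (_∸ d) v)) (seqs (n ∸ i) n)
      ≡⟨ cong (𝟙 (block? m m u) *_) (sumOver-seqs-above (n ∸ i) n d T) ⟩
    𝟙 (block? m m u) * tailCount n k l m i
      ∎

opWithBlock≡catalan*tailCount : ∀ n k l m′ i → 1 ≤ i → suc m′ + i ≤ n →
  opWithBlock n k l (suc m′) i ≡ catalan i * tailCount n k l (suc m′) i
opWithBlock≡catalan*tailCount n k l m′ i 1≤i m+i≤n = begin
  opWithBlock n k l m i                                     ≡⟨ opWithBlock≡blocks*tailCount n k l m′ i 1≤i i<n ⟩
  sumOver (𝟙 ∘ block? m m) (seqs i n) * tailCount n k l m i ≡⟨ cong (_* tailCount n k l m i) blocks≡ ⟩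
  catalan i * tailCount n k l m i                           ∎
  where
  open ≡-Reasoning
  m = suc m′
  i<n : i < n
  i<n = <-≤-trans (s≤s (m≤n+m i m′)) m+i≤n
  blocks≡ : sumOver (𝟙 ∘ block? m m) (seqs i n) ≡ catalan i
  blocks≡ = begin
    sumOver (𝟙 ∘ block? m m) (seqs i n) ≡⟨ blockCount i n m m (s≤s z≤n) ≤-refl (m≤n⇒m≤1+n m+i≤n) ⟩
    ballot i (m ∸ m)                    ≡⟨ cong (ballot i) (n∸n≡0 m) ⟩
    ballot i 0                          ≡⟨ catalan≡ballot i ⟨
    catalan i                           ∎

m+n+o≡p⇒m+o≡p∸n : ∀ m n o p → m + n + o ≡ p → m + o ≡ p ∸ n
m+n+o≡p⇒m+o≡p∸n m n o p e = trans (sym (m+n∸m≡n n (m + o))) (cong (_∸ n) (trans (swap m n o) e))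
  where
  swap : ∀ m n o → n + (m + o) ≡ m + n + o
  swap = solve-∀

1+m+o≡p∸n⇒1+m+n+o≡p : ∀ m n o p → suc m + o ≡ p ∸ n → suc m + n + o ≡ p
1+m+o≡p∸n⇒1+m+n+o≡p m n o p e with n ≤? p
... | yes n≤p = trans (swap (suc m) n o) (trans (cong (n +_) e) (m+[n∸m]≡n n≤p))
  where
  swap : ∀ m n o → m + n + o ≡ n + (m + o)
  swap = solve-∀
... | no n≰p = ⊥-elim (1+n≢0 (trans e (m≤n⇒m∸n≡0 (<⇒≤ (≰⇒> n≰p)))))

module _ (n k l m′ i : ℕ) (m≤k : suc m′ ≤ k) (i<n : i < n) where

  private
    m = suc m′
    d = m + i
    N = n ∸ i
    L = l ∸ i
    c = suc k ∸ m

    Shape : List ℕ → Set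
    Shape w = Ordered w × flaws N w ≡ k × maxEntry w ≡ L

    shape? : ∀ w → Dec (Shape w)
    shape? w = ordered? w ×-dec (flaws N w ≟ k) ×-dec (maxEntry w ≟ L)

    N∸m≡ : N ∸ m ≡ n ∸ d
    N∸m≡ = trans (∸-+-assoc n i m) (cong (n ∸_) (+-comm i m))

    end≡ : suc m + c ≡ suc (suc k)
    end≡ = cong suc (m+[n∸m]≡n (m≤n⇒m≤1+n m≤k))

    𝟙-opProp-∷ : ∀ j h w → 𝟙 (opProp? N k L j (h ∷ w)) ≡ 𝟙 (h ≟ j) * 𝟙 (shape? (h ∷ w))
    𝟙-opProp-∷ j h w = trans (𝟙-cong (λ (s , f , hd , mx) → just-injective hd , s , f , mx)
                                     (λ (h≡j , s , f , mx) → s , f , cong just h≡j , mx)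
                                     _ ((h ≟ j) ×-dec shape? (h ∷ w)))
                             (𝟙-× (h ≟ j) _)

    flaws-above-m : ∀ w → All (m <_) w → m ≤ N → flaws N w ≡ flaws (n ∸ d) (map (_∸ m) w)
    flaws-above-m w m<w m≤N = trans (flaws-shift N m w m≤N m<w) (cong (λ e → flaws e (map (_∸ m) w)) N∸m≡)

    sumFrom-opProp : ∀ w → length w ≡ N → InRange N w →
      sumFrom (suc m) c (λ j → 𝟙 (opProp? N k L j w))
      ≡ 𝟙 (all? (m <?_) w) * 𝟙 (tail? (n ∸ d) k d l (map (_∸ m) w))
    sumFrom-opProp [] ∣w∣≡N _ = ⊥-elim (<⇒≱ i<n (m∸n≡0⇒m≤n (sym ∣w∣≡N)))
    sumFrom-opProp (h ∷ w) ∣w∣≡N ((_ , h≤N) ∷ _) = begin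
      sumFrom (suc m) c (λ j → 𝟙 (opProp? N k L j W))
        ≡⟨ sumFrom-cong (suc m) c (λ j _ _ → 𝟙-opProp-∷ j h w) ⟩
      sumFrom (suc m) c (λ j → 𝟙 (h ≟ j) * 𝟙 (shape? W))
        ≡⟨ sumFrom-*ʳ (suc m) c _ (𝟙 (shape? W)) ⟩
      sumFrom (suc m) c (λ j → 𝟙 (h ≟ j)) * 𝟙 (shape? W)
        ≡⟨ cong (_* 𝟙 (shape? W)) (sumFrom-δ (suc m) c h) ⟩
      𝟙 range? * 𝟙 (shape? W)
        ≡⟨ 𝟙-× range? (shape? W) ⟨
      𝟙 (range? ×-dec shape? W)
        ≡⟨ 𝟙-cong to from _ (all? (m <?_) W ×-dec tail? (n ∸ d) k d l z) ⟩
      𝟙 (all? (m <?_) W ×-dec tail? (n ∸ d) k d l z)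
        ≡⟨ 𝟙-× (all? (m <?_) W) _ ⟩
      𝟙 (all? (m <?_) W) * 𝟙 (tail? (n ∸ d) k d l z)
        ∎
      where
      open ≡-Reasoning
      W = h ∷ w
      z = map (_∸ m) W
      range? = (suc m ≤? h) ×-dec (h <? suc m + c)
      to : (suc m ≤ h × h < suc m + c) × Shape W → All (m <_) W × Tail (n ∸ d) k d l z
      to ((m<h , _) , sorted , flaws≡k , max≡L) =
        m<W , Ordered-map-∸ m sorted
            , trans (sym (flaws-above-m W m<W (≤-trans (<⇒≤ m<h) h≤N))) flaws≡k
            , 1+m+o≡p∸n⇒1+m+n+o≡p m′ i _ l (trans (sym (maxEntry-shift m h w (All.map <⇒≤ m<W))) max≡L)
        where m<W = Ordered⇒All-< m<h sorted
      from : All (m <_) W × Tail (n ∸ d) k d l z → (suc m ≤ h × h < suc m + c) × Shape W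
      from (m<W@(m<h ∷ _) , sortedZ , flawsZ≡k , maxZ≡l) =
        (m<h , subst (h <_) (sym end≡) (s≤s h≤k+1)) , sorted , flaws≡k
          , trans (maxEntry-shift m h w (All.map <⇒≤ m<W)) (m+n+o≡p⇒m+o≡p∸n m i _ l maxZ≡l)
        where
        sorted = subst Ordered (map-+-∸ m W (All.map <⇒≤ m<W)) (Ordered-map-+ m sortedZ)
        flaws≡k = trans (flaws-above-m W m<W (≤-trans (<⇒≤ m<h) h≤N)) flawsZ≡k
        h≤k+1 = subst (λ f → h ≤ suc f) flaws≡k (head≤flaws+1 N h w sorted ∣w∣≡N h≤N)

  sumFrom-op≡tailCount : sumFrom (suc m) c (λ j → op N k L j) ≡ tailCount n k l m i
  sumFrom-op≡tailCount = begin
    sumFrom (suc m) c (λ j → op N k L j)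
      ≡⟨ sumFrom-cong (suc m) c (λ j _ _ → length-filter (opProp? N k L j) (seqs N N)) ⟩
    sumFrom (suc m) c (λ j → sumOver (𝟙 ∘ opProp? N k L j) (seqs N N))
      ≡⟨ sumOver-sumFrom (λ w j → 𝟙 (opProp? N k L j w)) (suc m) c (seqs N N) ⟨
    sumOver (λ w → sumFrom (suc m) c (λ j → 𝟙 (opProp? N k L j w))) (seqs N N)
      ≡⟨ sumOver-seqs-cong N N sumFrom-opProp ⟩
    sumOver (λ w → 𝟙 (all? (m <?_) w) * T (map (_∸ m) w)) (seqs N N)
      ≡⟨ sumOver-seqs-above N N m T ⟩
    sumOver T (seqs N (N ∸ m))
      ≡⟨ cong (λ e → sumOver T (seqs N e)) N∸m≡ ⟩
    tailCount n k l m i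
      ∎
    where
    open ≡-Reasoning
    T = 𝟙 ∘ tail? (n ∸ d) k d l

-- The first min(i, n − m′) cars of an initial block of length i all park, so at most
-- n − min(i, n − m′) cars fail; this is below k unless i ≤ n − k.
blockLength-bounds : ∀ n k l m′ as → length as ≡ n → suc m′ ≤ k → OpProp n k l (suc m′) as →
                     1 ≤ blockLength (suc m′) as × blockLength (suc m′) as ≤ n ∸ k
blockLength-bounds n k l m′ (x ∷ as′) ∣as∣≡n m≤k (sorted , flaws≡k , refl , _) =
  1≤blockLength m as′ , bl≤n∸k
  where
  m = suc m′
  as = m ∷ as′
  i = blockLength m as
  R = n ∸ m′
  k≤n : k ≤ n
  k≤n = subst₂ _≤_ flaws≡k ∣as∣≡n (flawsFrom≤length as (emptyStreet n))
  m′≤n : m′ ≤ n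
  m′≤n = ≤-trans (n≤1+n m′) (≤-trans m≤k k≤n)
  k≤n∸ : ∀ j → j ≤ i → j ≤ R → k ≤ n ∸ j
  k≤n∸ j j≤i j≤R = begin
    k                                   ≡⟨ flaws≡k ⟨
    flaws n as                          ≡⟨ cong (flaws n) (take++drop≡id j as) ⟨
    flaws n (take j as ++ drop j as)    ≡⟨ flaws-Block-++ n m′ (take j as) (drop j as) block m′≤n ∣take∣≤R ⟩
    flawsFrom (drop j as) _             ≤⟨ flawsFrom≤length (drop j as) _ ⟩
    length (drop j as)                  ≡⟨ trans (length-drop j as) (cong (_∸ j) ∣as∣≡n) ⟩
    n ∸ j                               ∎
    where
    open ≤-Reasoning
    block : Block m m (take j as)
    block = Block-take j m m as (≤-refl ∷ sorted) j≤i
    ∣take∣≤R : length (take j as) ≤ R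
    ∣take∣≤R = subst (_≤ R) (sym (length-take j as)) (≤-trans (m⊓n≤m j (length as)) j≤R)
  bl≤n∸k : i ≤ n ∸ k
  bl≤n∸k with i ≤? R
  ... | yes i≤R = m+n≤o⇒m≤o∸n i (subst (_≤ n) (+-comm k i) (m≤o∸n⇒m+n≤o k i≤n (k≤n∸ i ≤-refl i≤R)))
    where i≤n = ≤-trans i≤R (m∸n≤m n m′)
  ... | no i≰R  =
    ⊥-elim (<⇒≱ m≤k (subst (k ≤_) (m∸[m∸n]≡n m′≤n) (k≤n∸ R (<⇒≤ (≰⇒> i≰R)) ≤-refl)))

op≡sumFrom-opWithBlock : ∀ n k l m′ → suc m′ ≤ k →
                         op n k l (suc m′) ≡ sumFrom 1 (n ∸ k) (opWithBlock n k l (suc m′))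
op≡sumFrom-opWithBlock n k l m′ m≤k = begin
  op n k l m
    ≡⟨ length-filter (opProp? n k l m) (seqs n n) ⟩
  sumOver (𝟙 ∘ opProp? n k l m) (seqs n n)
    ≡⟨ sumOver-seqs-cong n n (λ as ∣as∣≡n _ → byBlockLength as ∣as∣≡n) ⟩
  sumOver (λ as → sumFrom 1 (n ∸ k) (λ i → W i as)) (seqs n n)
    ≡⟨ sumOver-sumFrom (λ as i → W i as) 1 (n ∸ k) (seqs n n) ⟩
  sumFrom 1 (n ∸ k) (opWithBlock n k l m)
    ∎
  where
  open ≡-Reasoning
  m = suc m′
  W : ℕ → List ℕ → ℕ
  W i as = 𝟙 (opProp? n k l m as ×-dec (blockLength m as ≟ i))
  byBlockLength : ∀ as → length as ≡ n → 𝟙 (opProp? n k l m as) ≡ sumFrom 1 (n ∸ k) (λ i → W i as)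
  byBlockLength as ∣as∣≡n = sym (begin
    sumFrom 1 (n ∸ k) (λ i → W i as)
      ≡⟨ sumFrom-cong 1 (n ∸ k) (λ i _ _ → 𝟙-× (opProp? n k l m as) (blockLength m as ≟ i)) ⟩
    sumFrom 1 (n ∸ k) (λ i → 𝟙 (opProp? n k l m as) * 𝟙 (blockLength m as ≟ i))
      ≡⟨ sumFrom-*ˡ 1 (n ∸ k) _ (𝟙 (opProp? n k l m as)) ⟩
    𝟙 (opProp? n k l m as) * sumFrom 1 (n ∸ k) (λ i → 𝟙 (blockLength m as ≟ i))
      ≡⟨ 𝟙-*-cong (opProp? n k l m as) δ≡1 ⟩
    𝟙 (opProp? n k l m as) * 1
      ≡⟨ *-identityʳ _ ⟩
    𝟙 (opProp? n k l m as)
      ∎)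
    where
    δ≡1 : OpProp n k l m as → sumFrom 1 (n ∸ k) (λ i → 𝟙 (blockLength m as ≟ i)) ≡ 1
    δ≡1 p = let (1≤bl , bl≤n∸k) = blockLength-bounds n k l m′ as ∣as∣≡n m≤k p
            in sumFrom-δ-in 1 (n ∸ k) (blockLength m as) 1≤bl (s≤s bl≤n∸k)

mainTheorem12 : (n k l m : ℕ) → 1 ≤ m → m ≤ k → suc k ≤ n → 1 ≤ l →
    op n k l m ≡ sumFromTo (suc m) (suc k) (λ j → sumFromTo 1 (n ∸ k) (λ i → catalan i * op (n ∸ i) k (l ∸ i) j))
mainTheorem12 n k l (suc m′) _ m≤k k<n _ = begin
  op n k l m                                                  ≡⟨ op≡sumFrom-opWithBlock n k l m′ m≤k ⟩
  sumFrom 1 (n ∸ k) (opWithBlock n k l m)                     ≡⟨ sumFrom-cong 1 (n ∸ k) perBlockLength ⟩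
  sumFrom 1 (n ∸ k) (λ i → sumFrom (suc m) c (λ j → F j i))   ≡⟨ sumFrom-comm (suc m) c 1 (n ∸ k) F ⟨
  sumFrom (suc m) c (λ j → sumFrom 1 (n ∸ k) (F j))           ≡⟨ sumFrom-cong (suc m) c (λ j _ _ → toSumFrom j) ⟨
  sumFrom (suc m) c (λ j → sumFromTo 1 (n ∸ k) (F j))         ≡⟨ sumFromTo≡sumFrom (suc m) (suc k) _ ⟨
  sumFromTo (suc m) (suc k) (λ j → sumFromTo 1 (n ∸ k) (F j)) ∎
  where
  open ≡-Reasoning
  m = suc m′
  c = suc k ∸ m
  F : ℕ → ℕ → ℕ
  F j i = catalan i * op (n ∸ i) k (l ∸ i) j
  toSumFrom : ∀ j → sumFromTo 1 (n ∸ k) (F j) ≡ sumFrom 1 (n ∸ k) (F j)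
  toSumFrom j = sumFromTo≡sumFrom 1 (n ∸ k) (F j)
  perBlockLength : ∀ i → 1 ≤ i → i < 1 + (n ∸ k) → opWithBlock n k l m i ≡ sumFrom (suc m) c (λ j → F j i)
  perBlockLength i 1≤i i≤n∸k = begin
    opWithBlock n k l m i                         ≡⟨ opWithBlock≡catalan*tailCount n k l m′ i 1≤i m+i≤n ⟩
    catalan i * tailCount n k l m i               ≡⟨ cong (catalan i *_) tail≡ ⟨
    catalan i * sumFrom (suc m) c (op (n ∸ i) k (l ∸ i)) ≡⟨ sumFrom-*ˡ (suc m) c _ (catalan i) ⟨
    sumFrom (suc m) c (λ j → F j i)               ∎
    where
    m+i≤n : m + i ≤ n
    m+i≤n = ≤-trans (+-mono-≤ m≤k (≤-pred i≤n∸k)) (≤-reflexive (m+[n∸m]≡n (<⇒≤ k<n)))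
    tail≡ = sumFrom-op≡tailCount n k l m′ i m≤k (≤-trans (s≤s (m≤n+m i m′)) m+i≤n)
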